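{- Let $n\geq 2$ and let $P_n$ be the path with vertices $v_1,\dots,v_n$ (edges $v_jv_{j+1}$). Then the set $\mathcal{R}(P_n)=\{\mathbf{r} : (\mathbf{d},\mathbf{r}) \text{ is an arithmetical structure on } P_n \text{ for some } \mathbf{d}\}$ equals $\{\mathbf{r}(U,\theta) : \{v_1,v_n\}\subseteq U\subseteq V(P_n),\ \theta \text{ an order on } V(P_n)\setminus U\}$.
   Context: An arithmetical structure on a graph $H$ with vertex set $W$ is a pair $(\mathbf{d},\mathbf{r})\in\mathbb{N}_+^W\times\mathbb{N}_+^W$ ($\mathbb{N}_+$ = positive integers) with $\gcd(\mathbf{r}_w:w\in W)=1$ and $(\mathrm{diag}(\mathbf{d})-A(H))\mathbf{r}^t=\mathbf{0}^t$, $A(H)$ the adjacency matrix. An order on a finite set $S$ with $m$ elements is a bijection $\theta:S\to\{1,\dots,m\}$. Given $\{v_1,v_n\}\subseteq U\subseteq V(P_n)$ and an order $\theta$ on $S=V(P_n)\setminus U$ with $m=|S|$, the vector $\mathbf{r}(U,\theta)\in\mathbb{N}^{V(P_n)}$ is computed as follows: start with $\mathbf{r}=\chi_U$ (the characteristic vector of $U$: $\mathbf{r}_u=1$ for $u\in U$, $0$ otherwise); for $k=1,\dots,m$ in turn, let $u=v_j=\theta^{ -1}(k)$, let $a$ be the largest index $<j$ with $\mathbf{r}_{v_a}\neq0$ and $b$ the smallest index $>j$ with $\mathbf{r}_{v_b}\neq 0$ (for the current $\mathbf{r}$), and set $\mathbf{r}_{v_j}=\mathbf{r}_{v_a}+\mathbf{r}_{v_b}$.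 The final vector is $\mathbf{r}(U,\theta)$. -}

module Defs where

open import Data.Nat using (ℕ; zero; suc; _+_; _*_; _<_; _<?_; ∣_-_∣)
open import Data.Nat.GCD using (gcd)
open import Data.Bool using (Bool; true; false; if_then_else_)
open import Data.Fin using (Fin; toℕ; fromℕ<)
open import Data.Fin.Subset using (Subset; _∉_; ∁; ∣_∣)
open import Data.Vec using (lookup)
open import Data.Vec.Functional using (Vector; foldr; foldl; updateAt)
open import Data.Product using (Σ; ∃; _×_; proj₁)
open import Function.Bundles using (_↔_; Inverse)
open import Relation.Binary.PropositionalEquality using (_≡_)
open import Relation.Nullary using (yes; no)

-- The path P_n : vertices v_1..v_n are represented by Fin n
-- (v_{i+1} ↔ the element i : Fin n); edges join consecutive vertices.

pathAdj : (n : ℕ) → Fin n → Fin n → ℕ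
pathAdj n i j with ∣ toℕ i - toℕ j ∣
... | 1 = 1
... | _ = 0

sumV : ∀ {n} → Vector ℕ n → ℕ
sumV = foldr _+_ 0

gcdV : ∀ {n} → Vector ℕ n → ℕ
gcdV = foldr gcd 0

-- (d , r) is an arithmetical structure on P_n:
-- d, r have positive entries, gcd(r) = 1, and (diag(d) - A(P_n)) rᵗ = 0,
-- the latter written row by row as d_i r_i = Σ_j A_ij r_j (over ℕ).
IsArithStruct : (n : ℕ) → Vector ℕ n → Vector ℕ n → Set
IsArithStruct n d r =
  ((i : Fin n) → 0 < d i) ×
  ((i : Fin n) → 0 < r i) ×
  (gcdV r ≡ 1) ×
  ((i : Fin n) → d i * r i ≡ sumV (λ j → pathAdj n i j * r j))

-- value of r at natural index i (0 if out of range)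
val : ∀ {n} → Vector ℕ n → ℕ → ℕ
val {n} r i with i <? n
... | yes p = r (fromℕ< p)
... | no _  = 0

-- value of r at the largest index < j with nonzero entry (0 if none)
leftNZ : ∀ {n} → Vector ℕ n → ℕ → ℕ
leftNZ r zero = 0
leftNZ r (suc i) with val r i
... | zero  = leftNZ r i
... | suc x = suc x

rightAux : ∀ {n} → Vector ℕ n → ℕ → ℕ → ℕ
rightAux r zero i = 0
rightAux r (suc f) i with val r i
... | zero  = rightAux r f (suc i)
... | suc x = suc x

-- value of r at the smallest index > j with nonzero entry (0 if none)
rightNZ : ∀ {n} → Vector ℕ n → ℕ → ℕ
rightNZ {n} r j = rightAux r n (suc j)

step : ∀ {n} → Vector ℕ n → Fin n → Vector ℕ n
step r j = updateAt r j (λ _ → leftNZ r (toℕ j) + rightNZ r (toℕ j))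

χ : ∀ {n} → Subset n → Vector ℕ n
χ U v = if lookup U v then 1 else 0

Compl : ∀ {n} → Subset n → Set
Compl {n} U = Σ (Fin n) (λ v → v ∉ U)

-- An order on S: a bijection θ : S → {1..m}, m = |S|
-- ({1..m} represented by Fin m, i.e. shifted down by one).
Order : ∀ {n} → Subset n → Set
Order U = Compl U ↔ Fin ∣ ∁ U ∣

rUθ : ∀ {n} (U : Subset n) → Order U → Vector ℕ n
rUθ U θ = foldl (λ r k → step r (proj₁ (Inverse.from θ k))) (χ U) (λ k → k)

-- An arithmetical structure on P_n is determined by r: r is positive, gcd r = 1, and r_a divides
-- r_(a-1) + r_(a+1) at every vertex; propagating these divisibilities along the path forces the two
-- end entries to be 1. Call a vector with zero entries admissible if its end entries are 1 and every
-- nonzero interior entry divides the sum of its nearest nonzero neighbours. One step of r(U, θ) fills a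
-- zero entry with that sum; this changes the neighbour sum of any other nonzero entry x by 0 or by x,
-- so admissibility is preserved in both directions. Starting from χ_U, every r(U, θ) is therefore
-- positive and admissible, i.e. an arithmetical structure. Conversely, if a positive admissible r has
-- an entry ≥ 2, its leftmost maximum M has nearest nonzero neighbours L < M and R ≤ M with
-- M ∣ L + R > 0, hence M = L + R: it is the last step of a construction. Zeroing it and recursing on the
-- entry sum ends at χ_U with U = {v : r_v = 1}; the zeroed vertices, in reverse, give θ.

module Submission where

open import Defs
open import Data.Bool using (true; false; if_then_else_; T)
import Data.Fin as Fin
open import Data.Fin using (Fin; zero; suc; toℕ; fromℕ; fromℕ<; inject)
open import Data.Fin.Permutation using (↔⇒≡)
open import Data.Fin.Properties
  using (toℕ<n; fromℕ<-toℕ; toℕ-fromℕ<; toℕ-fromℕ; toℕ-inject; toℕ-injective; ¬∀⟶∃¬-smallest; any?)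
  renaming (_≟_ to _≟ᶠ_; suc-injective to sucᶠ-injective)
open import Data.Fin.Subset using (Subset; _∈_; _∉_; ∁) renaming (∣_∣ to ∣_∣ˢ)
open import Data.Fin.Subset.Properties using (drop-there; _∈?_)
import Data.List as List
open import Data.List using (List; []; _∷_; [_]; _∷ʳ_)
open import Data.List.Extrema.Nat using (argmax; f[xs]≤f[argmax])
open import Data.List.Membership.Propositional using () renaming (_∈_ to _∈ₗ_; _∉_ to _∉ₗ_)
open import Data.List.Membership.Propositional.Properties
  using (∈-allFin; ∈-++⁺ˡ; ∈-++⁺ʳ; ∈-++⁻; ∈-tabulate⁺; ∈-tabulate⁻; ∈-lookup; ∈-map⁺; ∈-map⁻)
open import Data.List.Properties using (foldl-∷ʳ; length-map; tabulate-lookup)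
open import Data.List.Relation.Binary.Disjoint.Propositional using (Disjoint)
import Data.List.Relation.Unary.All as All
open import Data.List.Relation.Unary.AllPairs using ([]; _∷_)
import Data.List.Relation.Unary.Any as Any
open import Data.List.Relation.Unary.Any using (here; there)
open import Data.List.Relation.Unary.Any.Properties using (lookup-index)
open import Data.List.Relation.Unary.Unique.Propositional using (Unique)
open import Data.List.Relation.Unary.Unique.Propositional.Properties using (++⁺; tabulate⁺; map⁺)
open import Data.Nat
  using (ℕ; zero; suc; _+_; _*_; _∸_; ∣_-_∣; _≤_; _<_; z≤n; s≤s; z<s; _<?_; _≤?_; _≟_; _≡ᵇ_)
open import Data.Nat.Divisibility
  using ( _∣_; divides; quotient; ∣-refl; ∣-reflexive; ∣-trans; _∣0; 1∣_; ∣1⇒≡1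
        ; ∣m∣n⇒∣m+n; ∣m+n∣m⇒∣n)
open import Data.Nat.GCD using (gcd; gcd-greatest; gcd-zeroˡ)
open import Data.Nat.Properties
open import Algebra.Properties.CommutativeSemigroup +-commutativeSemigroup using (x∙yz≈xz∙y; xy∙z≈xz∙y)
import Data.Product
open import Data.Product using (Σ; ∃; _×_; _,_; proj₁; proj₂)
open import Data.Sum using (_⊎_; inj₁; inj₂)
open import Data.Unit using (tt)
import Data.Vec as Vec
open import Data.Vec using ([]; _∷_; here; there)
open import Data.Vec.Functional using (Vector; updateAt)
import Data.Vec.Functional as VF
open import Data.Vec.Functional.Properties using (updateAt-updates; updateAt-minimal)
open import Data.Vec.Properties using ([]=⇒lookup; lookup⇒[]=; lookup∘tabulate)
open import Function using (_∘_; id; case_of_)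
open import Function.Bundles using (_⇔_; mk⇔; Equivalence; _↔_; mk↔ₛ′; Inverse)
open import Function.Properties.Equivalence using () renaming (trans to ⇔-trans)
open import Function.Properties.Inverse using (↔-sym; ↔-trans)
open import Relation.Binary using (tri<; tri≈; tri>)
open import Relation.Binary.PropositionalEquality
  using (_≡_; _≢_; refl; sym; trans; cong; cong₂; subst; subst₂; _≗_; module ≡-Reasoning)
open import Relation.Nullary using (Dec; yes; no; contradiction; ¬?; _×-dec_)
open import Relation.Nullary.Decidable using (decidable-stable)

private
  variable
    n : ℕ

-- Nearest nonzero entries

nonzeroOr : ℕ → ℕ → ℕ
nonzeroOr zero    y = y
nonzeroOr (suc x) y = suc x

val-< : (r : Vector ℕ n) {m : ℕ} (m<n : m < n) → val r m ≡ r (fromℕ< m<n)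
val-< {n} r {m} m<n with m <? n
... | yes _   = refl
... | no  m≮n = contradiction m<n m≮n

val-≥ : (r : Vector ℕ n) {m : ℕ} → n ≤ m → val r m ≡ 0
val-≥ {n} r {m} n≤m with m <? n
... | yes m<n = contradiction n≤m (<⇒≱ m<n)
... | no  _   = refl

val-toℕ : (r : Vector ℕ n) (i : Fin n) → val r (toℕ i) ≡ r i
val-toℕ r i = trans (val-< r (toℕ<n i)) (cong r (fromℕ<-toℕ i (toℕ<n i)))

leftNZ-suc : (r : Vector ℕ n) (i : ℕ) → leftNZ r (suc i) ≡ nonzeroOr (val r i) (leftNZ r i)
leftNZ-suc r i with val r i
... | zero  = refl
... | suc _ = refl

rightAux-suc : (r : Vector ℕ n) (f i : ℕ) →
               rightAux r (suc f) i ≡ nonzeroOr (val r i) (rightAux r f (suc i))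
rightAux-suc r f i with val r i
... | zero  = refl
... | suc _ = refl

rightAux-beyond : (r : Vector ℕ n) (f : ℕ) {i : ℕ} → n ≤ i → rightAux r f i ≡ 0
rightAux-beyond r zero    n≤i = refl
rightAux-beyond r (suc f) {i} n≤i = begin
  rightAux r (suc f) i                        ≡⟨ rightAux-suc r f i ⟩
  nonzeroOr (val r i) (rightAux r f (suc i))  ≡⟨ cong₂ nonzeroOr (val-≥ r n≤i) rest≡0 ⟩
  0                                           ∎
  where
  open ≡-Reasoning
  rest≡0 : rightAux r f (suc i) ≡ 0
  rest≡0 = rightAux-beyond r f (m≤n⇒m≤1+n n≤i)

rightAux-fuel : (r : Vector ℕ n) (f : ℕ) {i : ℕ} → n ≤ i + f → rightAux r f i ≡ rightAux r (suc f) i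
rightAux-fuel r zero {i} n≤i+0 = sym (rightAux-beyond r 1 (≤-trans n≤i+0 (≤-reflexive (+-identityʳ i))))
rightAux-fuel {n} r (suc f) {i} n≤i+1+f = begin
  rightAux r (suc f) i                              ≡⟨ rightAux-suc r f i ⟩
  nonzeroOr (val r i) (rightAux r f (suc i))        ≡⟨ cong (nonzeroOr (val r i)) (rightAux-fuel r f n≤1+i+f) ⟩
  nonzeroOr (val r i) (rightAux r (suc f) (suc i))  ≡⟨ rightAux-suc r (suc f) i ⟨
  rightAux r (suc (suc f)) i                        ∎
  where
  open ≡-Reasoning
  n≤1+i+f : n ≤ suc i + f
  n≤1+i+f = ≤-trans n≤i+1+f (≤-reflexive (+-suc i f))

-- rightNZ r j is rightFrom r (suc j) by definition.
rightFrom : Vector ℕ n → ℕ → ℕ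
rightFrom {n} r = rightAux r n

rightFrom-suc : (r : Vector ℕ n) (i : ℕ) → rightFrom r i ≡ nonzeroOr (val r i) (rightFrom r (suc i))
rightFrom-suc {zero}  r i = cong (λ v → nonzeroOr v 0) (sym (val-≥ r {i} z≤n))
rightFrom-suc {suc n} r i =
  trans (rightAux-suc r n i) (cong (nonzeroOr (val r i)) (rightAux-fuel r n (s≤s (m≤n+m n i))))

rightFrom-beyond : (r : Vector ℕ n) {i : ℕ} → n ≤ i → rightFrom r i ≡ 0
rightFrom-beyond {n} r = rightAux-beyond r n

leftNZ-agree : (r s : Vector ℕ n) {c i : ℕ} → c ≤ i →
               (∀ {m} → c ≤ m → m < i → val r m ≡ val s m) →
               leftNZ r c ≡ leftNZ s c → leftNZ r i ≡ leftNZ s i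
leftNZ-agree r s {i = zero}  z≤n    agree base = base
leftNZ-agree r s {c} {suc i} c≤1+i agree base with m≤n⇒m<n∨m≡n c≤1+i
... | inj₂ refl      = base
... | inj₁ (s≤s c≤i) = begin
  leftNZ r (suc i)                  ≡⟨ leftNZ-suc r i ⟩
  nonzeroOr (val r i) (leftNZ r i)  ≡⟨ cong₂ nonzeroOr (agree c≤i ≤-refl) (leftNZ-agree r s c≤i agree′ base) ⟩
  nonzeroOr (val s i) (leftNZ s i)  ≡⟨ leftNZ-suc s i ⟨
  leftNZ s (suc i)                  ∎
  where
  open ≡-Reasoning
  agree′ : ∀ {m} → c ≤ m → m < i → val r m ≡ val s m
  agree′ c≤m m<i = agree c≤m (m<n⇒m<1+n m<i)

leftNZ-skip : (r : Vector ℕ n) {i b : ℕ} → i ≤ b →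
              (∀ {m} → i ≤ m → m < b → val r m ≡ 0) → leftNZ r b ≡ leftNZ r i
leftNZ-skip r {b = zero}  z≤n    zeros = refl
leftNZ-skip r {i} {suc b} i≤1+b zeros with m≤n⇒m<n∨m≡n i≤1+b
... | inj₂ refl      = refl
... | inj₁ (s≤s i≤b) = begin
  leftNZ r (suc b)                  ≡⟨ leftNZ-suc r b ⟩
  nonzeroOr (val r b) (leftNZ r b)  ≡⟨ cong (λ v → nonzeroOr v (leftNZ r b)) (zeros i≤b ≤-refl) ⟩
  leftNZ r b                        ≡⟨ leftNZ-skip r i≤b (λ i≤m m<b → zeros i≤m (m<n⇒m<1+n m<b)) ⟩
  leftNZ r i                        ∎
  where open ≡-Reasoning

rightFrom-agree : (r s : Vector ℕ n) {i c : ℕ} → i ≤ c →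
                  (∀ {m} → i ≤ m → m < c → val r m ≡ val s m) →
                  rightFrom r c ≡ rightFrom s c → rightFrom r i ≡ rightFrom s i
rightFrom-agree r s {i} {c} i≤c agree base = go (c ∸ i) (m∸n+n≡m i≤c) ≤-refl
  where
  open ≡-Reasoning
  go : ∀ d {j} → d + j ≡ c → i ≤ j → rightFrom r j ≡ rightFrom s j
  go zero    refl _   = base
  go (suc d) {j} refl i≤j = begin
    rightFrom r j                                ≡⟨ rightFrom-suc r j ⟩
    nonzeroOr (val r j) (rightFrom r (suc j))
      ≡⟨ cong₂ nonzeroOr (agree i≤j (m<n+m j z<s)) (go d (+-suc d j) (m≤n⇒m≤1+n i≤j)) ⟩
    nonzeroOr (val s j) (rightFrom s (suc j))    ≡⟨ rightFrom-suc s j ⟨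
    rightFrom s j                                ∎

rightFrom-skip : (r : Vector ℕ n) {i b : ℕ} → i ≤ b →
                 (∀ {m} → i ≤ m → m < b → val r m ≡ 0) → rightFrom r i ≡ rightFrom r b
rightFrom-skip r {i} {b} i≤b zeros = go (b ∸ i) (m∸n+n≡m i≤b) ≤-refl
  where
  open ≡-Reasoning
  go : ∀ d {j} → d + j ≡ b → i ≤ j → rightFrom r j ≡ rightFrom r b
  go zero    refl _   = refl
  go (suc d) {j} refl i≤j = begin
    rightFrom r j                              ≡⟨ rightFrom-suc r j ⟩
    nonzeroOr (val r j) (rightFrom r (suc j))
      ≡⟨ cong (λ v → nonzeroOr v (rightFrom r (suc j))) (zeros i≤j (m<n+m j z<s)) ⟩
    rightFrom r (suc j)                        ≡⟨ go d (+-suc d j) (m≤n⇒m≤1+n i≤j) ⟩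
    rightFrom r (suc (d + j))                  ∎

leftNZ-cong : (r s : Vector ℕ n) {i : ℕ} → (∀ {m} → m < i → val r m ≡ val s m) → leftNZ r i ≡ leftNZ s i
leftNZ-cong r s agree = leftNZ-agree r s z≤n (λ _ → agree) refl

rightFrom-cong : (r s : Vector ℕ n) {i : ℕ} → (∀ {m} → i ≤ m → val r m ≡ val s m) →
                 rightFrom r i ≡ rightFrom s i
rightFrom-cong {n} r s {i} agree = rightFrom-agree r s (m≤m+n i n) (λ i≤m _ → agree i≤m)
  (trans (rightFrom-beyond r (m≤n+m n i)) (sym (rightFrom-beyond s (m≤n+m n i))))

neighbourSum : Vector ℕ n → ℕ → ℕ
neighbourSum r a = leftNZ r a + rightNZ r a

neighbourSum-cong-off : (r s : Vector ℕ n) {j : ℕ} → (∀ {m} → m ≢ j → val r m ≡ val s m) →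
                        neighbourSum r j ≡ neighbourSum s j
neighbourSum-cong-off r s agree =
  cong₂ _+_ (leftNZ-cong r s (agree ∘ <⇒≢)) (rightFrom-cong r s (agree ∘ >⇒≢))

nonzeroOr-≢0 : {x : ℕ} (y : ℕ) → x ≢ 0 → nonzeroOr x y ≡ x
nonzeroOr-≢0 {zero}  y x≢0 = contradiction refl x≢0
nonzeroOr-≢0 {suc x} y _   = refl

leftNZ-nonzero : (r : Vector ℕ n) {m : ℕ} → val r m ≢ 0 → leftNZ r (suc m) ≡ val r m
leftNZ-nonzero r {m} rm≢0 = trans (leftNZ-suc r m) (nonzeroOr-≢0 _ rm≢0)

rightFrom-nonzero : (r : Vector ℕ n) {m : ℕ} → val r m ≢ 0 → rightFrom r m ≡ val r m
rightFrom-nonzero r {m} rm≢0 = trans (rightFrom-suc r m) (nonzeroOr-≢0 _ rm≢0)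

nonzero-between? : (g : ℕ → ℕ) (a b : ℕ) →
                   (∃ λ m → a < m × m < b × g m ≢ 0) ⊎ (∀ {m} → a < m → m < b → g m ≡ 0)
nonzero-between? g a b with anyUpTo? (λ m → a <? m ×-dec ¬? (g m ≟ 0)) b
... | yes (m , m<b , a<m , gm≢0) = inj₁ (m , a<m , m<b , gm≢0)
... | no  ∄m                     =
  inj₂ λ {m} a<m m<b → decidable-stable (g m ≟ 0) (λ gm≢0 → ∄m (m , m<b , a<m , gm≢0))

-- Filling a hole

record FillsHole (h : Vector ℕ n) (j : ℕ) (h′ : Vector ℕ n) : Set where
  field
    unchanged : ∀ {m} → m ≢ j → val h′ m ≡ val h m
    hole      : val h j ≡ 0
    filled    : val h′ j ≡ neighbourSum h j

module _ {h h′ : Vector ℕ n} {j : ℕ} (fill : FillsHole h j h′) where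
  open FillsHole fill
  open ≡-Reasoning

  neighbourSum-hole : neighbourSum h′ j ≡ neighbourSum h j
  neighbourSum-hole = neighbourSum-cong-off h′ h unchanged

  nonzero-unchanged : ∀ {m} → m ≢ j → val h m ≢ 0 → val h′ m ≢ 0
  nonzero-unchanged m≢j hm≢0 h′m≡0 = hm≢0 (trans (sym (unchanged m≢j)) h′m≡0)

  private
    unchanged-below : ∀ {m} → m < j → val h′ m ≡ val h m
    unchanged-below = unchanged ∘ <⇒≢

    unchanged-above : ∀ {m} → j < m → val h′ m ≡ val h m
    unchanged-above = unchanged ∘ >⇒≢

    leftNZ-fill-≤ : ∀ {a} → a ≤ j → leftNZ h′ a ≡ leftNZ h a
    leftNZ-fill-≤ a≤j = leftNZ-cong h′ h (λ m<a → unchanged-below (<-≤-trans m<a a≤j))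

    rightFrom-fill-> : ∀ {i} → j < i → rightFrom h′ i ≡ rightFrom h i
    rightFrom-fill-> j<i = rightFrom-cong h′ h (λ i≤m → unchanged-above (<-≤-trans j<i i≤m))

  neighbourSum-fill-below : ∀ {a} → a < j → val h a ≢ 0 →
    neighbourSum h′ a ≡ neighbourSum h a ⊎ neighbourSum h′ a ≡ neighbourSum h a + val h a
  neighbourSum-fill-below {a} a<j ha≢0 with nonzero-between? (val h) a j
  ... | inj₁ (m , a<m , m<j , hm≢0) = inj₁ (cong₂ _+_ (leftNZ-fill-≤ (<⇒≤ a<j)) right-same)
    where
    right-same : rightFrom h′ (suc a) ≡ rightFrom h (suc a)
    right-same = rightFrom-agree h′ h a<m (λ _ k<m → unchanged-below (<-trans k<m m<j)) (begin
      rightFrom h′ m  ≡⟨ rightFrom-nonzero h′ (nonzero-unchanged (<⇒≢ m<j) hm≢0) ⟩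
      val h′ m        ≡⟨ unchanged-below m<j ⟩
      val h m         ≡⟨ rightFrom-nonzero h hm≢0 ⟨
      rightFrom h m   ∎)
  ... | inj₂ zeros = inj₂ (begin
    leftNZ h′ a + rightFrom h′ (suc a)            ≡⟨ cong₂ _+_ (leftNZ-fill-≤ (<⇒≤ a<j)) right-new ⟩
    leftNZ h a + (val h a + rightFrom h (suc a))  ≡⟨ x∙yz≈xz∙y (leftNZ h a) (val h a) (rightFrom h (suc a)) ⟩
    leftNZ h a + rightFrom h (suc a) + val h a    ∎)
    where
    zeros-to-hole : ∀ {m} → suc a ≤ m → m < suc j → val h m ≡ 0
    zeros-to-hole {m} a<m m<1+j with m≤n⇒m<n∨m≡n (≤-pred m<1+j)
    ... | inj₁ m<j  = zeros a<m m<j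
    ... | inj₂ refl = hole
    filled≡ : val h′ j ≡ val h a + rightFrom h (suc a)
    filled≡ = trans filled (cong₂ _+_ (trans (leftNZ-skip h a<j zeros) (leftNZ-nonzero h ha≢0))
                                      (sym (rightFrom-skip h (s≤s (<⇒≤ a<j)) zeros-to-hole)))
    right-new : rightFrom h′ (suc a) ≡ val h a + rightFrom h (suc a)
    right-new = begin
      rightFrom h′ (suc a)  ≡⟨ rightFrom-skip h′ a<j (λ a<m m<j → trans (unchanged-below m<j) (zeros a<m m<j)) ⟩
      rightFrom h′ j        ≡⟨ rightFrom-nonzero h′ (λ h′j≡0 → ha≢0 (m+n≡0⇒m≡0 _ (trans (sym filled≡) h′j≡0))) ⟩
      val h′ j              ≡⟨ filled≡ ⟩
      val h a + rightFrom h (suc a) ∎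

  neighbourSum-fill-above : ∀ {a} → j < a → val h a ≢ 0 →
    neighbourSum h′ a ≡ neighbourSum h a ⊎ neighbourSum h′ a ≡ neighbourSum h a + val h a
  neighbourSum-fill-above {a} j<a ha≢0 with nonzero-between? (val h) j a
  ... | inj₁ (m , j<m , m<a , hm≢0) = inj₁ (cong₂ _+_ left-same (rightFrom-fill-> (m<n⇒m<1+n j<a)))
    where
    left-same : leftNZ h′ a ≡ leftNZ h a
    left-same = leftNZ-agree h′ h m<a (λ m<k _ → unchanged-above (<-trans j<m m<k)) (begin
      leftNZ h′ (suc m)  ≡⟨ leftNZ-nonzero h′ (nonzero-unchanged (>⇒≢ j<m) hm≢0) ⟩
      val h′ m           ≡⟨ unchanged-above j<m ⟩
      val h m            ≡⟨ leftNZ-nonzero h hm≢0 ⟨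
      leftNZ h (suc m)   ∎)
  ... | inj₂ zeros = inj₂ (begin
    leftNZ h′ a + rightFrom h′ (suc a)          ≡⟨ cong₂ _+_ left-new (rightFrom-fill-> (m<n⇒m<1+n j<a)) ⟩
    leftNZ h j + val h a + rightFrom h (suc a)  ≡⟨ xy∙z≈xz∙y (leftNZ h j) (val h a) (rightFrom h (suc a)) ⟩
    leftNZ h j + rightFrom h (suc a) + val h a  ≡⟨ cong (λ l → l + rightFrom h (suc a) + val h a) left-old ⟨
    leftNZ h a + rightFrom h (suc a) + val h a  ∎)
    where
    zeros-from-hole : ∀ {m} → j ≤ m → m < a → val h m ≡ 0
    zeros-from-hole {m} j≤m m<a with m≤n⇒m<n∨m≡n j≤m
    ... | inj₁ j<m  = zeros j<m m<a
    ... | inj₂ refl = hole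
    left-old : leftNZ h a ≡ leftNZ h j
    left-old = leftNZ-skip h (<⇒≤ j<a) zeros-from-hole
    filled≡ : val h′ j ≡ leftNZ h j + val h a
    filled≡ = trans filled (cong (leftNZ h j +_) (trans (rightFrom-skip h j<a zeros) (rightFrom-nonzero h ha≢0)))
    left-new : leftNZ h′ a ≡ leftNZ h j + val h a
    left-new = begin
      leftNZ h′ a        ≡⟨ leftNZ-skip h′ j<a (λ j<m m<a → trans (unchanged-above j<m) (zeros j<m m<a)) ⟩
      leftNZ h′ (suc j)  ≡⟨ leftNZ-nonzero h′ (λ h′j≡0 → ha≢0 (m+n≡0⇒n≡0 (leftNZ h j) (trans (sym filled≡) h′j≡0))) ⟩
      val h′ j           ≡⟨ filled≡ ⟩
      leftNZ h j + val h a ∎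

  neighbourSum-fill : ∀ {a} → a ≢ j → val h a ≢ 0 →
    neighbourSum h′ a ≡ neighbourSum h a ⊎ neighbourSum h′ a ≡ neighbourSum h a + val h a
  neighbourSum-fill {a} a≢j ha≢0 with <-cmp a j
  ... | tri< a<j _ _ = neighbourSum-fill-below a<j ha≢0
  ... | tri≈ _ a≡j _ = contradiction a≡j a≢j
  ... | tri> _ _ j<a = neighbourSum-fill-above j<a ha≢0

∣⇔∣+self : ∀ {d m m′} → m′ ≡ m ⊎ m′ ≡ m + d → d ∣ m ⇔ d ∣ m′
∣⇔∣+self         (inj₁ refl) = mk⇔ id id
∣⇔∣+self {d} {m} (inj₂ refl) = mk⇔ (λ d∣m → ∣m∣n⇒∣m+n d∣m ∣-refl)
                                   (λ d∣m+d → ∣m+n∣m⇒∣n (subst (d ∣_) (+-comm m d) d∣m+d) ∣-refl)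

-- A partially constructed r(U, θ): zero entries are the vertices not yet assigned a value.
record Admissible {k : ℕ} (r : Vector ℕ (suc (suc k))) : Set where
  field
    first≡1       : val r 0 ≡ 1
    last≡1        : val r (suc k) ≡ 1
    ∣neighbourSum : ∀ {a} → 0 < a → a < suc k → val r a ≢ 0 → val r a ∣ neighbourSum r a

admissible-fill : ∀ {k} {h h′ : Vector ℕ (suc (suc k))} {j} → FillsHole h j h′ → 0 < j → j < suc k →
                  Admissible h ⇔ Admissible h′
admissible-fill {k} {h} {h′} {j} fill 0<j j<1+k = mk⇔ forward backward
  where
  open FillsHole fill
  first-unchanged : val h′ 0 ≡ val h 0
  first-unchanged = unchanged (<⇒≢ 0<j)
  last-unchanged : val h′ (suc k) ≡ val h (suc k)
  last-unchanged = unchanged (>⇒≢ j<1+k)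
  ∣neighbourSum⇔ : ∀ {a} → a ≢ j → val h a ≢ 0 →
                   val h a ∣ neighbourSum h a ⇔ val h′ a ∣ neighbourSum h′ a
  ∣neighbourSum⇔ a≢j ha≢0 =
    subst (λ v → _ ⇔ v ∣ _) (sym (unchanged a≢j)) (∣⇔∣+self (neighbourSum-fill fill a≢j ha≢0))

  forward : Admissible h → Admissible h′
  forward adm = record
    { first≡1       = trans first-unchanged (Admissible.first≡1 adm)
    ; last≡1        = trans last-unchanged (Admissible.last≡1 adm)
    ; ∣neighbourSum = ∣neighbourSum′
    }
    where
    ∣neighbourSum′ : ∀ {a} → 0 < a → a < suc k → val h′ a ≢ 0 → val h′ a ∣ neighbourSum h′ a
    ∣neighbourSum′ {a} 0<a a<1+k h′a≢0 with a ≟ j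
    ... | yes refl = ∣-reflexive (trans filled (sym (neighbourSum-hole fill)))
    ... | no  a≢j  = Equivalence.to (∣neighbourSum⇔ a≢j ha≢0)
                       (Admissible.∣neighbourSum adm 0<a a<1+k ha≢0)
      where ha≢0 = λ ha≡0 → h′a≢0 (trans (unchanged a≢j) ha≡0)

  backward : Admissible h′ → Admissible h
  backward adm = record
    { first≡1       = trans (sym first-unchanged) (Admissible.first≡1 adm)
    ; last≡1        = trans (sym last-unchanged) (Admissible.last≡1 adm)
    ; ∣neighbourSum = ∣neighbourSum′
    }
    where
    ∣neighbourSum′ : ∀ {a} → 0 < a → a < suc k → val h a ≢ 0 → val h a ∣ neighbourSum h a
    ∣neighbourSum′ {a} 0<a a<1+k ha≢0 with a ≟ j
    ... | yes refl = contradiction hole ha≢0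
    ... | no  a≢j  = Equivalence.from (∣neighbourSum⇔ a≢j ha≢0)
                       (Admissible.∣neighbourSum adm 0<a a<1+k (nonzero-unchanged fill a≢j ha≢0))

val-cong : {r s : Vector ℕ n} → r ≗ s → ∀ m → val r m ≡ val s m
val-cong {n} r≗s m with m <? n
... | yes m<n = r≗s (fromℕ< m<n)
... | no  _   = refl

admissible-resp-≗ : ∀ {k} {r s : Vector ℕ (suc (suc k))} → r ≗ s → Admissible r → Admissible s
admissible-resp-≗ {k} {r} {s} r≗s adm = record
  { first≡1       = trans (sym (val-cong r≗s 0)) first≡1
  ; last≡1        = trans (sym (val-cong r≗s (suc k))) last≡1
  ; ∣neighbourSum = λ {a} 0<a a<1+k sa≢0 →
      subst₂ _∣_ (val-cong r≗s a) (neighbourSum-cong-off r s {a} (λ {m} _ → val-cong r≗s m))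
        (∣neighbourSum 0<a a<1+k (λ ra≡0 → sa≢0 (trans (sym (val-cong r≗s a)) ra≡0)))
  }
  where open Admissible adm

-- Steps of the construction

val-updateAt-≢ : (r : Vector ℕ n) (i : Fin n) {f : ℕ → ℕ} {m : ℕ} → m ≢ toℕ i →
                 val (updateAt r i f) m ≡ val r m
val-updateAt-≢ {n} r i {m = m} m≢i with m <? n
... | yes m<n = updateAt-minimal (fromℕ< m<n) i r (λ m≡i → m≢i (trans (sym (toℕ-fromℕ< m<n)) (cong toℕ m≡i)))
... | no  _   = refl

val-updateAt-same : (r : Vector ℕ n) (i : Fin n) {f : ℕ → ℕ} → val (updateAt r i f) (toℕ i) ≡ f (r i)
val-updateAt-same r i = trans (val-toℕ _ i) (updateAt-updates i r)

step-cong : {r s : Vector ℕ n} → r ≗ s → ∀ j → step r j ≗ step s j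
step-cong {r = r} {s} r≗s j p with p ≟ᶠ j
... | yes refl = begin
  step r p p                ≡⟨ updateAt-updates p r ⟩
  neighbourSum r (toℕ p)    ≡⟨ neighbourSum-cong-off r s (λ {m} _ → val-cong r≗s m) ⟩
  neighbourSum s (toℕ p)    ≡⟨ updateAt-updates p s ⟨
  step s p p                ∎
  where open ≡-Reasoning
... | no  p≢j  = trans (updateAt-minimal p j r p≢j) (trans (r≗s p) (sym (updateAt-minimal p j s p≢j)))

step-fills : (r : Vector ℕ n) (j : Fin n) → r j ≡ 0 → FillsHole r (toℕ j) (step r j)
step-fills r j rj≡0 = record
  { unchanged = val-updateAt-≢ r j
  ; hole      = trans (val-toℕ r j) rj≡0
  ; filled    = val-updateAt-same r j
  }

zeroAt : Vector ℕ n → Fin n → Vector ℕ n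
zeroAt s j = updateAt s j (λ _ → 0)

module _ (s : Vector ℕ n) (j : Fin n) (sj≡sum : s j ≡ neighbourSum s (toℕ j)) where

  neighbourSum-zeroAt : neighbourSum (zeroAt s j) (toℕ j) ≡ neighbourSum s (toℕ j)
  neighbourSum-zeroAt = neighbourSum-cong-off (zeroAt s j) s (val-updateAt-≢ s j)

  zeroAt-fills : FillsHole (zeroAt s j) (toℕ j) s
  zeroAt-fills = record
    { unchanged = sym ∘ val-updateAt-≢ s j
    ; hole      = val-updateAt-same s j
    ; filled    = trans (val-toℕ s j) (trans sj≡sum (sym neighbourSum-zeroAt))
    }

  step-zeroAt : step (zeroAt s j) j ≗ s
  step-zeroAt p with p ≟ᶠ j
  ... | yes refl = trans (updateAt-updates p (zeroAt s p)) (trans neighbourSum-zeroAt (sym sj≡sum))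
  ... | no  p≢j  = trans (updateAt-minimal p j _ p≢j) (updateAt-minimal p j s p≢j)

-- Running a schedule

Positive : Vector ℕ n → Set
Positive r = ∀ i → 0 < r i

Interior : ∀ {k} → Fin (suc (suc k)) → Set
Interior {k} j = 0 < toℕ j × toℕ j < suc k

run : Vector ℕ n → List (Fin n) → Vector ℕ n
run = List.foldl step

0<nonzeroOr : ∀ x {y} → 0 < y → 0 < nonzeroOr x y
0<nonzeroOr zero    0<y = 0<y
0<nonzeroOr (suc x) _   = z<s

leftNZ-pos : (r : Vector ℕ n) → val r 0 ≡ 1 → ∀ {i} → 0 < i → 0 < leftNZ r i
leftNZ-pos r r0≡1 {suc zero}    _ =
  subst (0 <_) (sym (leftNZ-suc r 0)) (subst (λ v → 0 < nonzeroOr v 0) (sym r0≡1) z<s)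
leftNZ-pos r r0≡1 {suc (suc i)} _ =
  subst (0 <_) (sym (leftNZ-suc r (suc i))) (0<nonzeroOr (val r (suc i)) (leftNZ-pos r r0≡1 z<s))

neighbourSum-pos : (r : Vector ℕ n) → val r 0 ≡ 1 → ∀ {a} → 0 < a → 0 < neighbourSum r a
neighbourSum-pos r r0≡1 0<a = ≤-trans (leftNZ-pos r r0≡1 0<a) (m≤m+n _ _)

run-positive-admissible : ∀ {k} (s : Vector ℕ (suc (suc k))) (π : List (Fin (suc (suc k)))) →
  Unique π → (∀ {j} → j ∈ₗ π → Interior j × s j ≡ 0) → (∀ p → p ∉ₗ π → 0 < s p) →
  Admissible s → Positive (run s π) × Admissible (run s π)
run-positive-admissible s []      _                holes pos adm = (λ p → pos p λ ()) , adm
run-positive-admissible s (j ∷ π) (j∉π ∷ uniqueπ) holes pos adm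
  with (0<j , j<1+k) , sj≡0 ← holes (here refl)
  = run-positive-admissible (step s j) π uniqueπ holes′ pos′ adm′
  where
  adm′ : Admissible (step s j)
  adm′ = Equivalence.to (admissible-fill (step-fills s j sj≡0) 0<j j<1+k) adm
  holes′ : ∀ {i} → i ∈ₗ π → Interior i × step s j i ≡ 0
  holes′ {i} i∈π with i-interior , si≡0 ← holes (there i∈π)
    = i-interior , trans (updateAt-minimal i j s (λ i≡j → All.lookup j∉π i∈π (sym i≡j))) si≡0
  pos′ : ∀ p → p ∉ₗ π → 0 < step s j p
  pos′ p p∉π with p ≟ᶠ j
  ... | yes refl = subst (0 <_) (sym (updateAt-updates p s))
                     (neighbourSum-pos s (Admissible.first≡1 adm) 0<j)
  ... | no  p≢j  = subst (0 <_) (sym (updateAt-minimal p j s p≢j))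
                     (pos p λ { (here p≡j) → p≢j p≡j ; (there p∈π) → p∉π p∈π })

-- Arithmetical structures on the path

ArithStructure : Vector ℕ n → Set
ArithStructure {n} r = Σ (Vector ℕ n) (λ d → IsArithStruct n d r)

unitDistance : ℕ → ℕ
unitDistance 1 = 1
unitDistance _ = 0

pathAdj-unitDistance : (i j : Fin n) → pathAdj n i j ≡ unitDistance ∣ toℕ i - toℕ j ∣
pathAdj-unitDistance i j with ∣ toℕ i - toℕ j ∣
... | zero          = refl
... | suc zero      = refl
... | suc (suc _)   = refl

-- The row sum of A(P_n) at vertex a, for the entries g extended by zero outside the path.
adjacentSum : (ℕ → ℕ) → ℕ → ℕ
adjacentSum g zero    = g 1
adjacentSum g (suc a) = g a + g (suc (suc a))

sumV-cong : {f g : Vector ℕ n} → f ≗ g → sumV f ≡ sumV g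
sumV-cong {zero}  f≗g = refl
sumV-cong {suc n} f≗g = cong₂ _+_ (f≗g zero) (sumV-cong (f≗g ∘ suc))

sumV-zero : sumV {n} (λ _ → 0) ≡ 0
sumV-zero {zero}  = refl
sumV-zero {suc n} = sumV-zero {n}

sumV-unitDistance : ∀ n a (g : ℕ → ℕ) → a < n → (∀ {b} → n ≤ b → g b ≡ 0) →
  sumV {n} (λ j → unitDistance ∣ a - toℕ j ∣ * g (toℕ j)) ≡ adjacentSum g a
sumV-unitDistance (suc zero)    zero          g _ beyond = sym (beyond (s≤s z≤n))
sumV-unitDistance (suc (suc n)) zero          g _ _      =
  trans (cong (λ t → g 1 + 0 + t) (sumV-zero {n})) (trans (+-identityʳ _) (+-identityʳ _))
sumV-unitDistance (suc n) (suc zero)    g (s≤s a<n) beyond =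
  cong₂ _+_ (+-identityʳ (g 0)) (sumV-unitDistance n 0 (g ∘ suc) a<n (beyond ∘ s≤s))
sumV-unitDistance (suc n) (suc (suc a)) g (s≤s a<n) beyond =
  sumV-unitDistance n (suc a) (g ∘ suc) a<n (beyond ∘ s≤s)

rowSum≡adjacentSum : (r : Vector ℕ n) (i : Fin n) →
                     sumV (λ j → pathAdj n i j * r j) ≡ adjacentSum (val r) (toℕ i)
rowSum≡adjacentSum {n} r i = trans
  (sumV-cong (λ j → cong₂ _*_ (pathAdj-unitDistance i j) (sym (val-toℕ r j))))
  (sumV-unitDistance n (toℕ i) (val r) (toℕ<n i) (val-≥ r))

val-positive : {r : Vector ℕ n} → Positive r → ∀ {m} → m < n → val r m ≢ 0
val-positive {r = r} pos m<n rm≡0 = <⇒≢ (pos _) (sym (trans (sym (val-< r m<n)) rm≡0))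

rightFrom-positive : {r : Vector ℕ n} → Positive r → ∀ m → rightFrom r m ≡ val r m
rightFrom-positive {n} {r} pos m with <-≤-connex m n
... | inj₁ m<n = rightFrom-nonzero r (val-positive pos m<n)
... | inj₂ n≤m = trans (rightFrom-beyond r n≤m) (sym (val-≥ r n≤m))

neighbourSum-positive : {r : Vector ℕ n} → Positive r → ∀ {a} → a < n →
                        neighbourSum r a ≡ adjacentSum (val r) a
neighbourSum-positive         pos {zero}  _   = rightFrom-positive pos 1
neighbourSum-positive {r = r} pos {suc a} a<n = cong₂ _+_
  (leftNZ-nonzero r (val-positive pos (<-trans (n<1+n a) a<n))) (rightFrom-positive pos (suc (suc a)))

module _ {r : Vector ℕ n} (rows : ∀ {a} → a < n → val r a ∣ adjacentSum (val r) a) {x : ℕ} where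
  private
    Consecutive : ℕ → Set
    Consecutive c = x ∣ val r c × x ∣ val r (suc c)

    upward : ∀ d {c} → Consecutive c → Consecutive (d + c)
    upward zero    x∣c = x∣c
    upward (suc d) {c} x∣c with upward d x∣c | <-≤-connex (suc (d + c)) n
    ... | x∣c′ , x∣c′+1 | inj₁ c′+1<n = x∣c′+1 , ∣m+n∣m⇒∣n (∣-trans x∣c′+1 (rows c′+1<n)) x∣c′
    ... | _    , x∣c′+1 | inj₂ n≤c′+1 =
      x∣c′+1 , subst (x ∣_) (sym (val-≥ r (m≤n⇒m≤1+n n≤c′+1))) (x ∣0)

    downward : ∀ {c} → c < n → Consecutive c → ∀ {b} → b ≤ c → Consecutive b
    downward {zero}  _   x∣c z≤n   = x∣c
    downward {suc c} c<n (x∣c+1 , x∣c+2) b≤c+1 with m≤n⇒m<n∨m≡n b≤c+1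
    ... | inj₂ refl      = x∣c+1 , x∣c+2
    ... | inj₁ (s≤s b≤c) = downward (<-trans (n<1+n c) c<n) (x∣c , x∣c+1) b≤c
      where
      x∣c = ∣m+n∣m⇒∣n (subst (x ∣_) (+-comm (val r c) _) (∣-trans x∣c+1 (rows c<n))) x∣c+2

  ∣consecutive⇒∣all : ∀ {a} → a < n → x ∣ val r a → x ∣ val r (suc a) → ∀ b → x ∣ val r b
  ∣consecutive⇒∣all {a} a<n x∣a x∣a+1 b with ≤-total a b
  ... | inj₁ a≤b = proj₁ (subst Consecutive (m∸n+n≡m a≤b) (upward (b ∸ a) (x∣a , x∣a+1)))
  ... | inj₂ b≤a = proj₁ (downward a<n (x∣a , x∣a+1) b≤a)

gcdV-greatest : (r : Vector ℕ n) {x : ℕ} → (∀ i → x ∣ r i) → x ∣ gcdV r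
gcdV-greatest {zero}  r x∣r = _ ∣0
gcdV-greatest {suc n} r x∣r = gcd-greatest (x∣r zero) (gcdV-greatest (r ∘ suc) (x∣r ∘ suc))

quotient-pos : ∀ {d m} → 0 < m → (d∣m : d ∣ m) → 0 < quotient d∣m
quotient-pos 0<m (divides zero    refl) = contradiction 0<m (<-irrefl refl)
quotient-pos _   (divides (suc q) _)    = z<s

module _ {k : ℕ} {r : Vector ℕ (suc (suc k))} where
  private
    N : ℕ
    N = suc (suc k)

  arithStructure⇒positive-admissible : ArithStructure r → Positive r × Admissible r
  arithStructure⇒positive-admissible (d , _ , pos , gcd≡1 , balance) = pos , record
    { first≡1       = ∣1⇒≡1 (divides-gcd (∣consecutive⇒∣all rows z<s ∣-refl (rows z<s)))
    ; last≡1        = ∣1⇒≡1 (divides-gcd (∣consecutive⇒∣all rows ≤-refl ∣-refl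
                        (subst (val r (suc k) ∣_) (sym (val-≥ r ≤-refl)) (val r (suc k) ∣0))))
    ; ∣neighbourSum = λ {a} _ a<1+k _ →
        subst (val r a ∣_) (sym (neighbourSum-positive pos (m<n⇒m<1+n a<1+k))) (rows (m<n⇒m<1+n a<1+k))
    }
    where
    rows : ∀ {a} → a < N → val r a ∣ adjacentSum (val r) a
    rows {a} a<N = subst₂ (λ v b → v ∣ adjacentSum (val r) b) (sym (val-< r a<N)) (toℕ-fromℕ< a<N)
      (divides (d i) (sym (trans (balance i) (rowSum≡adjacentSum r i))))
      where i = fromℕ< a<N
    divides-gcd : ∀ {x} → (∀ b → x ∣ val r b) → x ∣ 1
    divides-gcd {x} x∣r =
      subst (x ∣_) gcd≡1 (gcdV-greatest r (λ i → subst (x ∣_) (val-toℕ r i) (x∣r (toℕ i))))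

  positive-admissible⇒arithStructure : Positive r → Admissible r → ArithStructure r
  positive-admissible⇒arithStructure pos adm =
    (λ i → quotient (row i)) ,
    (λ i → quotient-pos (adjacentSum-pos (toℕ<n i)) (row i)) ,
    pos ,
    trans (cong (λ v → gcd v (gcdV (r ∘ suc))) (trans (sym (val-toℕ r zero)) (Admissible.first≡1 adm)))
          (gcd-zeroˡ (gcdV (r ∘ suc))) ,
    (λ i → trans (sym (_∣_.equality (row i))) (sym (rowSum≡adjacentSum r i)))
    where
    rows : ∀ {a} → a < N → val r a ∣ adjacentSum (val r) a
    rows {zero}  _   = subst (_∣ val r 1) (sym (Admissible.first≡1 adm)) (1∣ val r 1)
    rows {suc a} a<N with m≤n⇒m<n∨m≡n (≤-pred a<N)
    ... | inj₁ a<1+k = subst (val r (suc a) ∣_) (neighbourSum-positive pos a<N)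
                         (Admissible.∣neighbourSum adm z<s a<1+k (val-positive pos a<N))
    ... | inj₂ refl  = subst (_∣ adjacentSum (val r) (suc k)) (sym (Admissible.last≡1 adm)) (1∣ _)
    row : ∀ i → r i ∣ adjacentSum (val r) (toℕ i)
    row i = subst (_∣ adjacentSum (val r) (toℕ i)) (val-toℕ r i) (rows (toℕ<n i))
    adjacentSum-pos : ∀ {a} → a < N → 0 < adjacentSum (val r) a
    adjacentSum-pos {zero}  _   = n≢0⇒n>0 (val-positive pos (s≤s (s≤s z≤n)))
    adjacentSum-pos {suc a} a<N = ≤-trans (n≢0⇒n>0 (val-positive pos (<-trans (n<1+n a) a<N))) (m≤m+n _ _)

-- Undoing the construction

IsLeftmostMaximum : Vector ℕ n → Fin n → Set
IsLeftmostMaximum s j = (∀ p → s p ≤ s j) × (∀ {m} → m < toℕ j → val s m < s j)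

maximum⇒leftmostMaximum : (s : Vector ℕ n) (j₀ : Fin n) → (∀ p → s p ≤ s j₀) → ∃ (IsLeftmostMaximum s)
maximum⇒leftmostMaximum {n} s j₀ below-j₀
  with j , sj≮M , before ←
         ¬∀⟶∃¬-smallest n (λ i → s i < s j₀) (λ i → s i <? s j₀) (λ all< → <-irrefl refl (all< j₀))
  = j , below-j , before-j
  where
  sj≡M : s j ≡ s j₀
  sj≡M = ≤-antisym (below-j₀ j) (≮⇒≥ sj≮M)
  below-j : ∀ p → s p ≤ s j
  below-j p = subst (s p ≤_) (sym sj≡M) (below-j₀ p)
  before-j : ∀ {m} → m < toℕ j → val s m < s j
  before-j {m} m<j = subst₂ _<_ (sym (trans (val-< s m<n) (cong s inject≡))) (sym sj≡M) (before (fromℕ< m<j))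
    where
    m<n : m < n
    m<n = <-trans m<j (toℕ<n j)
    inject≡ : fromℕ< m<n ≡ inject (fromℕ< m<j)
    inject≡ = toℕ-injective (trans (toℕ-fromℕ< m<n) (sym (trans (toℕ-inject (fromℕ< m<j)) (toℕ-fromℕ< m<j))))

leftmostMaximum : (s : Vector ℕ (suc n)) → ∃ (IsLeftmostMaximum s)
leftmostMaximum {n} s = maximum⇒leftmostMaximum s j₀
  (λ p → All.lookup (f[xs]≤f[argmax] {f = s} zero (List.allFin (suc n))) (∈-allFin p))
  where
  j₀ : Fin (suc n)
  j₀ = argmax s zero (List.allFin (suc n))

nonzeroOr-pres : (P : ℕ → Set) {x y : ℕ} → P x → P y → P (nonzeroOr x y)
nonzeroOr-pres P {zero}  _  Py = Py
nonzeroOr-pres P {suc x} Px _  = Px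

leftNZ-< : (r : Vector ℕ n) {M : ℕ} → 0 < M → ∀ {i} → (∀ {m} → m < i → val r m < M) → leftNZ r i < M
leftNZ-< r 0<M {zero}  _      = 0<M
leftNZ-< r {M} 0<M {suc i} before = subst (_< M) (sym (leftNZ-suc r i))
  (nonzeroOr-pres (_< M) (before ≤-refl) (leftNZ-< r 0<M (before ∘ m<n⇒m<1+n)))

rightAux-≤ : (r : Vector ℕ n) {M : ℕ} → (∀ m → val r m ≤ M) → ∀ f i → rightAux r f i ≤ M
rightAux-≤ r all≤ zero    i = z≤n
rightAux-≤ r {M} all≤ (suc f) i = subst (_≤ M) (sym (rightAux-suc r f i))
  (nonzeroOr-pres (_≤ M) (all≤ i) (rightAux-≤ r all≤ f (suc i)))

m∣n∧0<n<m+m⇒n≡m : ∀ {M x} → M ∣ x → 0 < x → x < M + M → x ≡ M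
m∣n∧0<n<m+m⇒n≡m {M} (divides zero    refl) 0<x _ = contradiction 0<x (<-irrefl refl)
m∣n∧0<n<m+m⇒n≡m {M} (divides (suc zero) refl) _ _ = +-identityʳ M
m∣n∧0<n<m+m⇒n≡m {M} (divides (suc (suc q)) refl) _ x<2M =
  contradiction x<2M (≤⇒≯ (+-monoʳ-≤ M (m≤m+n M (q * M))))

leftmostMaximum-fills : ∀ {k} {s : Vector ℕ (suc (suc k))} → Admissible s → ∀ {j} →
  IsLeftmostMaximum s j → 2 ≤ s j → Interior j × s j ≡ neighbourSum s (toℕ j)
leftmostMaximum-fills {k} {s} adm {j} (below-j , before-j) 2≤M = interior , sym sum≡M
  where
  open Admissible adm
  sj≢1 : ∀ {m} → val s m ≡ 1 → toℕ j ≢ m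
  sj≢1 sm≡1 refl = <⇒≢ 2≤M (sym (trans (sym (val-toℕ s j)) sm≡1))
  interior : Interior j
  interior = n≢0⇒n>0 (sj≢1 first≡1) , ≤∧≢⇒< (≤-pred (toℕ<n j)) (sj≢1 last≡1)
  all≤ : ∀ m → val s m ≤ s j
  all≤ m with <-≤-connex m (suc (suc k))
  ... | inj₁ m<n = subst (_≤ s j) (sym (val-< s m<n)) (below-j _)
  ... | inj₂ n≤m = subst (_≤ s j) (sym (val-≥ s n≤m)) z≤n
  M∣sum : s j ∣ neighbourSum s (toℕ j)
  M∣sum = subst (_∣ neighbourSum s (toℕ j)) (val-toℕ s j) (∣neighbourSum (proj₁ interior) (proj₂ interior)
    (λ sj≡0 → <⇒≢ (<-trans z<s 2≤M) (sym (trans (sym (val-toℕ s j)) sj≡0))))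
  sum≡M : neighbourSum s (toℕ j) ≡ s j
  sum≡M = m∣n∧0<n<m+m⇒n≡m M∣sum (neighbourSum-pos s first≡1 (proj₁ interior))
    (+-mono-<-≤ (leftNZ-< s (<-trans z<s 2≤M) before-j) (rightAux-≤ s all≤ _ (suc (toℕ j))))

χ-∈ : (U : Subset n) {p : Fin n} → p ∈ U → χ U p ≡ 1
χ-∈ U p∈U = cong (λ b → if b then 1 else 0) ([]=⇒lookup p∈U)

χ-∉ : (U : Subset n) {p : Fin n} → p ∉ U → χ U p ≡ 0
χ-∉ U {p} p∉U with Vec.lookup U p in Up
... | true  = contradiction (lookup⇒[]= p U Up) p∉U
... | false = refl

≤1∧≢0⇒≡1 : ∀ {x} → x ≤ 1 → x ≢ 0 → x ≡ 1
≤1∧≢0⇒≡1 {zero}  _         x≢0 = contradiction refl x≢0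
≤1∧≢0⇒≡1 {suc x} (s≤s x≤0) _   = cong suc (n≤0⇒n≡0 x≤0)

val-χ-≤1 : (U : Subset n) (m : ℕ) → val (χ U) m ≤ 1
val-χ-≤1 {n} U m with <-≤-connex m n
... | inj₁ m<n = subst (_≤ 1) (sym (val-< (χ U) m<n)) (χ-≤1 (Vec.lookup U (fromℕ< m<n)))
  where
  χ-≤1 : ∀ b → (if b then 1 else 0) ≤ 1
  χ-≤1 true  = ≤-refl
  χ-≤1 false = z≤n
... | inj₂ n≤m = subst (_≤ 1) (sym (val-≥ (χ U) n≤m)) z≤n

IsOnes : Vector ℕ n → Subset n → Set
IsOnes s U = ∀ p → p ∈ U ⇔ s p ≡ 1

χ-IsOnes : {s : Vector ℕ n} {U : Subset n} → IsOnes s U → (∀ p → s p ≤ 1) → χ U ≗ s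
χ-IsOnes {s = s} {U} ones ≤1 p with m≤n⇒m<n∨m≡n (≤1 p)
... | inj₂ sp≡1       = trans (χ-∈ U (Equivalence.from (ones p) sp≡1)) (sym sp≡1)
... | inj₁ (s≤s sp≤0) = trans (χ-∉ U p∉U) (sym sp≡0)
  where
  sp≡0 : s p ≡ 0
  sp≡0 = n≤0⇒n≡0 sp≤0
  p∉U : p ∉ U
  p∉U p∈U = <⇒≢ z<s (sym (trans (sym (Equivalence.to (ones p) p∈U)) sp≡0))

ones : Vector ℕ n → Subset n
ones r = Vec.tabulate (λ p → r p ≡ᵇ 1)

ones-IsOnes : (r : Vector ℕ n) → IsOnes r (ones r)
ones-IsOnes r p = mk⇔
  (λ p∈ → ≡ᵇ⇒≡ (r p) 1 (subst T (trans (sym ([]=⇒lookup p∈)) lookup-ones) tt))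
  (λ rp≡1 → lookup⇒[]= p (ones r) (trans lookup-ones (cong (_≡ᵇ 1) rp≡1)))
  where
  lookup-ones : Vec.lookup (ones r) p ≡ (r p ≡ᵇ 1)
  lookup-ones = lookup∘tabulate (λ q → r q ≡ᵇ 1) p

2≤⇔≢1 : ∀ {x} → 0 < x → 2 ≤ x ⇔ x ≢ 1
2≤⇔≢1 0<x = mk⇔ (λ 2≤x x≡1 → <⇒≢ 2≤x (sym x≡1)) (λ x≢1 → ≤∧≢⇒< 0<x (x≢1 ∘ sym))

sumV-zeroAt : (s : Vector ℕ n) (j : Fin n) → sumV (zeroAt s j) + s j ≡ sumV s
sumV-zeroAt s zero    = +-comm (sumV (s ∘ suc)) (s zero)
sumV-zeroAt s (suc j) =
  trans (+-assoc (s zero) _ (s (suc j))) (cong (s zero +_) (sumV-zeroAt (s ∘ suc) j))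

sumV-zeroAt-< : (s : Vector ℕ n) (j : Fin n) → 0 < s j → sumV (zeroAt s j) < sumV s
sumV-zeroAt-< s j 0<sj = subst (sumV (zeroAt s j) <_) (sumV-zeroAt s j) (m<m+n _ 0<sj)

IsOnes-zeroAt : {s : Vector ℕ n} {U : Subset n} {j : Fin n} → IsOnes s U → 2 ≤ s j → IsOnes (zeroAt s j) U
IsOnes-zeroAt {s = s} {U} {j} ones 2≤sj p with p ≟ᶠ j
... | yes refl = mk⇔ (λ p∈U → contradiction (subst (2 ≤_) (Equivalence.to (ones p) p∈U) 2≤sj) λ { (s≤s ()) })
                     (λ zeroAt≡1 → contradiction (trans (sym (updateAt-updates p s)) zeroAt≡1) λ ())
... | no  p≢j  = subst (λ v → p ∈ U ⇔ v ≡ 1) (sym (updateAt-minimal p j s p≢j)) (ones p)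

Reconstruction : Subset n → Vector ℕ n → List (Fin n) → Set
Reconstruction U s π = Unique π × (∀ p → p ∈ₗ π ⇔ 2 ≤ s p) × run (χ U) π ≗ s

reconstruction-∷ʳ : {U : Subset n} {s : Vector ℕ n} {π : List (Fin n)} {j : Fin n} →
  s j ≡ neighbourSum s (toℕ j) → 2 ≤ s j → Reconstruction U (zeroAt s j) π → Reconstruction U s (π ∷ʳ j)
reconstruction-∷ʳ {U = U} {s} {π} {j} sj≡sum 2≤sj (uniqueπ , ∈π⇔ , runπ≗) =
  ++⁺ uniqueπ (All.[] ∷ []) disjoint , ∈⇔ , run≗
  where
  zeroAt-j : zeroAt s j j ≡ 0
  zeroAt-j = updateAt-updates j s
  disjoint : Disjoint π [ j ]
  disjoint (j∈π , here refl) = contradiction (subst (2 ≤_) zeroAt-j (Equivalence.to (∈π⇔ _) j∈π)) λ ()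
  ∈⇔ : ∀ p → p ∈ₗ π ∷ʳ j ⇔ 2 ≤ s p
  ∈⇔ p with p ≟ᶠ j
  ... | yes refl = mk⇔ (λ _ → 2≤sj) (λ _ → ∈-++⁺ʳ π (here refl))
  ... | no  p≢j  = mk⇔
    (λ p∈π∷ʳj → case ∈-++⁻ π p∈π∷ʳj of λ where
      (inj₁ p∈π)        → subst (2 ≤_) (updateAt-minimal p j s p≢j) (Equivalence.to (∈π⇔ p) p∈π)
      (inj₂ (here p≡j)) → contradiction p≡j p≢j)
    (λ 2≤sp → ∈-++⁺ˡ (Equivalence.from (∈π⇔ p) (subst (2 ≤_) (sym (updateAt-minimal p j s p≢j)) 2≤sp)))
  run≗ : run (χ U) (π ∷ʳ j) ≗ s
  run≗ p = begin
    run (χ U) (π ∷ʳ j) p         ≡⟨ cong (λ r → r p) (foldl-∷ʳ step (χ U) j π) ⟩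
    step (run (χ U) π) j p       ≡⟨ step-cong runπ≗ j p ⟩
    step (zeroAt s j) j p        ≡⟨ step-zeroAt s j sj≡sum p ⟩
    s p                          ∎
    where open ≡-Reasoning

reconstruct : ∀ {k} (U : Subset (suc (suc k))) bound (s : Vector ℕ (suc (suc k))) →
  sumV s < bound → Admissible s → IsOnes s U → ∃ (Reconstruction U s)
reconstruct U (suc bound) s sum<bound adm ones = byMaximum (any? (λ p → 2 ≤? s p))
  where
  zeroMaximum : ∃ (IsLeftmostMaximum s) → (∃ λ p → 2 ≤ s p) → ∃ (Reconstruction U s)
  zeroMaximum (j , maximum@(below-j , _)) (p₀ , 2≤sp₀)
    with (0<j , j<1+k) , sj≡sum ← leftmostMaximum-fills adm maximum (≤-trans 2≤sp₀ (below-j p₀))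
    = Data.Product.map (_∷ʳ j) (reconstruction-∷ʳ {U = U} sj≡sum 2≤sj)
        (reconstruct U bound (zeroAt s j) sum′<bound adm′ (IsOnes-zeroAt ones 2≤sj))
    where
    2≤sj : 2 ≤ s j
    2≤sj = ≤-trans 2≤sp₀ (below-j p₀)
    adm′ : Admissible (zeroAt s j)
    adm′ = Equivalence.from (admissible-fill (zeroAt-fills s j sj≡sum) 0<j j<1+k) adm
    sum′<bound : sumV (zeroAt s j) < bound
    sum′<bound = <-≤-trans (sumV-zeroAt-< s j (<-trans z<s 2≤sj)) (≤-pred sum<bound)
  byMaximum : Dec (∃ λ p → 2 ≤ s p) → ∃ (Reconstruction U s)
  byMaximum (no ∄2≤)           = [] , [] , (λ p → mk⇔ (λ ()) (λ 2≤sp → contradiction (p , 2≤sp) ∄2≤)) ,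
                                 χ-IsOnes ones (λ p → ≤-pred (≰⇒> (∄2≤ ∘ (p ,_))))
  byMaximum (yes (p₀ , 2≤sp₀)) = zeroMaximum (leftmostMaximum s) (p₀ , 2≤sp₀)

-- Orders and schedules

Schedule : Subset n → List (Fin n) → Set
Schedule U π = Unique π × (∀ p → p ∈ₗ π ⇔ p ∉ U)

scheduleOf : {U : Subset n} → Order U → List (Fin n)
scheduleOf θ = List.tabulate (proj₁ ∘ Inverse.from θ)

foldl-tabulate : {A B C : Set} {m : ℕ} (g : B → A → B) (f : C → A) (z : B) (ys : Vector C m) →
  VF.foldl (λ b k → g b (f k)) z ys ≡ List.foldl g z (List.tabulate (f ∘ ys))
foldl-tabulate {m = zero}  g f z ys = refl
foldl-tabulate {m = suc m} g f z ys = foldl-tabulate g f (g z (f (ys zero))) (ys ∘ suc)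

rUθ≡run : {U : Subset n} (θ : Order U) → rUθ U θ ≡ run (χ U) (scheduleOf θ)
rUθ≡run {U = U} θ = foldl-tabulate step (proj₁ ∘ Inverse.from θ) (χ U) id

-- Two proofs of p ∉ U are equal: the empty type is proof-irrelevant in the standard library.
Compl-≡ : {U : Subset n} {x y : Compl U} → proj₁ x ≡ proj₁ y → x ≡ y
Compl-≡ refl = refl

order-schedule : {U : Subset n} (θ : Order U) → Schedule U (scheduleOf θ)
order-schedule {U = U} θ = tabulate⁺ from-injective , ∈⇔
  where
  open Inverse θ
  from-injective : ∀ {i j} → proj₁ (from i) ≡ proj₁ (from j) → i ≡ j
  from-injective {i} {j} eq = begin
    i              ≡⟨ strictlyInverseˡ i ⟨
    to (from i)    ≡⟨ cong to (Compl-≡ eq) ⟩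
    to (from j)    ≡⟨ strictlyInverseˡ j ⟩
    j              ∎
    where open ≡-Reasoning
  ∈⇔ : ∀ p → p ∈ₗ scheduleOf θ ⇔ p ∉ U
  ∈⇔ p = mk⇔
    (λ p∈ → case ∈-tabulate⁻ p∈ of λ where (i , refl) → proj₂ (from i))
    (λ p∉U → subst (_∈ₗ scheduleOf θ) (cong proj₁ (strictlyInverseʳ (p , p∉U)))
                                       (∈-tabulate⁺ (to (p , p∉U))))

lookup-injective : {A : Set} {xs : List A} → Unique xs → ∀ {i j} → List.lookup xs i ≡ List.lookup xs j → i ≡ j
lookup-injective (_ ∷ _)        {zero}  {zero}  _  = refl
lookup-injective (x∉xs ∷ _)     {zero}  {suc j} eq = contradiction eq (All.lookup x∉xs (∈-lookup j))
lookup-injective (x∉xs ∷ _)     {suc i} {zero}  eq = contradiction (sym eq) (All.lookup x∉xs (∈-lookup i))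
lookup-injective (_ ∷ uniquexs) {suc i} {suc j} eq = cong suc (lookup-injective uniquexs eq)

schedule↔ : {U : Subset n} {π : List (Fin n)} → Schedule U π → Compl U ↔ Fin (List.length π)
schedule↔ {U = U} {π} (uniqueπ , ∈⇔) = mk↔ₛ′ to from to∘from from∘to
  where
  to : Compl U → Fin (List.length π)
  to (p , p∉U) = Any.index (Equivalence.from (∈⇔ p) p∉U)
  from : Fin (List.length π) → Compl U
  from k = List.lookup π k , Equivalence.to (∈⇔ _) (∈-lookup k)
  to∘from : ∀ k → to (from k) ≡ k
  to∘from k = lookup-injective uniqueπ (sym (lookup-index (Equivalence.from (∈⇔ _) _)))
  from∘to : ∀ x → from (to x) ≡ x
  from∘to (p , p∉U) = Compl-≡ (sym (lookup-index (Equivalence.from (∈⇔ p) p∉U)))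

complementList : Subset n → List (Fin n)
complementList []          = []
complementList (true  ∷ U) = List.map suc (complementList U)
complementList (false ∷ U) = zero ∷ List.map suc (complementList U)

length-complementList : (U : Subset n) → List.length (complementList U) ≡ ∣ ∁ U ∣ˢ
length-complementList []          = refl
length-complementList (true  ∷ U) = trans (length-map suc (complementList U)) (length-complementList U)
length-complementList (false ∷ U) = cong suc (trans (length-map suc (complementList U)) (length-complementList U))

zero∉map-suc : (xs : List (Fin n)) → zero ∉ₗ List.map suc xs
zero∉map-suc xs zero∈ with ∈-map⁻ Fin.suc zero∈
... | _ , _ , ()

suc∈map-suc⇔ : (xs : List (Fin n)) {p : Fin n} → suc p ∈ₗ List.map suc xs ⇔ p ∈ₗ xs
suc∈map-suc⇔ xs = mk⇔ (λ p∈ → case ∈-map⁻ Fin.suc p∈ of λ where (_ , q∈ , refl) → q∈) (∈-map⁺ Fin.suc)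

complementList-schedule : (U : Subset n) → Schedule U (complementList U)
complementList-schedule []      = [] , λ ()
complementList-schedule (b ∷ U) = unique b , ∈⇔∉ b
  where
  sucs : List (Fin (suc _))
  sucs = List.map suc (complementList U)
  unique-sucs : Unique sucs
  unique-sucs = map⁺ sucᶠ-injective (proj₁ (complementList-schedule U))
  suc∈sucs⇔∉ : ∀ {b p} → suc p ∈ₗ sucs ⇔ suc p ∉ b ∷ U
  suc∈sucs⇔∉ {p = p} = ⇔-trans (suc∈map-suc⇔ (complementList U))
    (⇔-trans (proj₂ (complementList-schedule U) p) (mk⇔ (_∘ drop-there) (_∘ there)))
  unique : ∀ b → Unique (complementList (b ∷ U))
  unique true  = unique-sucs
  unique false = All.tabulate (λ y∈ zero≡y → zero∉map-suc _ (subst (_∈ₗ sucs) (sym zero≡y) y∈)) ∷ unique-sucs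
  ∈⇔∉ : ∀ b p → p ∈ₗ complementList (b ∷ U) ⇔ p ∉ b ∷ U
  ∈⇔∉ true  zero    = mk⇔ (λ zero∈ → contradiction zero∈ (zero∉map-suc _))
                           (λ zero∉ → contradiction here zero∉)
  ∈⇔∉ true  (suc p) = suc∈sucs⇔∉
  ∈⇔∉ false zero    = mk⇔ (λ { _ () }) (λ _ → here refl)
  ∈⇔∉ false (suc p) = mk⇔ (λ { (there p∈) → Equivalence.to suc∈sucs⇔∉ p∈ })
                           (there ∘ Equivalence.from suc∈sucs⇔∉)

schedule-length : {U : Subset n} {π : List (Fin n)} → Schedule U π → List.length π ≡ ∣ ∁ U ∣ˢ
schedule-length {U = U} sch = trans
  (↔⇒≡ (↔-trans (↔-sym (schedule↔ sch)) (schedule↔ (complementList-schedule U))))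
  (length-complementList U)

schedule⇒order : {U : Subset n} {π : List (Fin n)} → Schedule U π →
                 Σ (Order U) (λ θ → rUθ U θ ≡ run (χ U) π)
schedule⇒order {U = U} {π} sch =
  θ , trans (rUθ≡run θ) (cong (run (χ U)) (scheduleOf-subst (schedule-length sch)))
  where
  θ : Order U
  θ = subst (λ m → Compl U ↔ Fin m) (schedule-length sch) (schedule↔ sch)
  scheduleOf-subst : ∀ {m} (eq : List.length π ≡ m) →
    List.tabulate (proj₁ ∘ Inverse.from (subst (λ m → Compl U ↔ Fin m) eq (schedule↔ sch))) ≡ π
  scheduleOf-subst refl = tabulate-lookup π

module _ {k : ℕ} where
  private
    N : ℕ
    N = suc (suc k)

  ScheduleConstructible : Vector ℕ N → Set
  ScheduleConstructible r = Σ (Subset N) λ U → zero ∈ U × fromℕ (suc k) ∈ U ×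
    Σ (List (Fin N)) λ π → Schedule U π × r ≗ run (χ U) π

  OrderConstructible : Vector ℕ N → Set
  OrderConstructible r = Σ (Subset N) λ U → zero ∈ U × fromℕ (suc k) ∈ U ×
    Σ (Order U) λ θ → r ≗ rUθ U θ

  toℕ≡0⇒≡zero : {p : Fin N} → toℕ p ≡ 0 → p ≡ zero
  toℕ≡0⇒≡zero {zero} _ = refl

  toℕ≡1+k⇒≡fromℕ : {p : Fin N} → toℕ p ≡ suc k → p ≡ fromℕ (suc k)
  toℕ≡1+k⇒≡fromℕ eq = toℕ-injective (trans eq (sym (toℕ-fromℕ (suc k))))

  χ-admissible : {U : Subset N} → zero ∈ U → fromℕ (suc k) ∈ U → Admissible (χ U)
  χ-admissible {U} 0∈U last∈U = record
    { first≡1       = trans (val-toℕ (χ U) zero) (χ-∈ U 0∈U)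
    ; last≡1        = trans (cong (val (χ U)) (sym (toℕ-fromℕ (suc k))))
                            (trans (val-toℕ (χ U) (fromℕ (suc k))) (χ-∈ U last∈U))
    ; ∣neighbourSum = λ {a} _ _ χa≢0 →
        subst (_∣ neighbourSum (χ U) a) (sym (≤1∧≢0⇒≡1 (val-χ-≤1 U a) χa≢0)) (1∣ _)
    }

  scheduleConstructible⇒arithStructure : {r : Vector ℕ N} → ScheduleConstructible r → ArithStructure r
  scheduleConstructible⇒arithStructure (U , 0∈U , last∈U , π , (uniqueπ , ∈⇔) , r≗run) =
    positive-admissible⇒arithStructure (λ p → subst (0 <_) (sym (r≗run p)) (proj₁ built p))
                                       (admissible-resp-≗ (sym ∘ r≗run) (proj₂ built))
    where
    holes : ∀ {p} → p ∈ₗ π → Interior p × χ U p ≡ 0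
    holes {p} p∈π =
      (n≢0⇒n>0 (λ p≡0 → p∉U (subst (_∈ U) (sym (toℕ≡0⇒≡zero p≡0)) 0∈U)) ,
       ≤∧≢⇒< (≤-pred (toℕ<n p)) (λ p≡1+k → p∉U (subst (_∈ U) (sym (toℕ≡1+k⇒≡fromℕ p≡1+k)) last∈U))) ,
      χ-∉ U p∉U
      where
      p∉U : p ∉ U
      p∉U = Equivalence.to (∈⇔ p) p∈π
    outside : ∀ p → p ∉ₗ π → 0 < χ U p
    outside p p∉π =
      subst (0 <_) (sym (χ-∈ U (decidable-stable (p ∈? U) (p∉π ∘ Equivalence.from (∈⇔ p))))) z<s
    built : Positive (run (χ U) π) × Admissible (run (χ U) π)
    built = run-positive-admissible (χ U) π uniqueπ holes outside (χ-admissible 0∈U last∈U)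

  arithStructure⇒scheduleConstructible : {r : Vector ℕ N} → ArithStructure r → ScheduleConstructible r
  arithStructure⇒scheduleConstructible {r} arith
    with pos , adm ← arithStructure⇒positive-admissible arith
    with π , uniqueπ , ∈π⇔ , run≗r ← reconstruct (ones r) (suc (sumV r)) r ≤-refl adm (ones-IsOnes r)
    = ones r , first∈ , last∈ , π , (uniqueπ , ∈π⇔∉) , sym ∘ run≗r
    where
    open Admissible adm
    first∈ : zero ∈ ones r
    first∈ = Equivalence.from (ones-IsOnes r zero) (trans (sym (val-toℕ r zero)) first≡1)
    last∈ : fromℕ (suc k) ∈ ones r
    last∈ = Equivalence.from (ones-IsOnes r (fromℕ (suc k)))
      (trans (sym (val-toℕ r (fromℕ (suc k)))) (trans (cong (val r) (toℕ-fromℕ (suc k))) last≡1))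
    ∈π⇔∉ : ∀ p → p ∈ₗ π ⇔ p ∉ ones r
    ∈π⇔∉ p = ⇔-trans (∈π⇔ p) (⇔-trans (2≤⇔≢1 (pos p))
      (mk⇔ (_∘ Equivalence.to (ones-IsOnes r p)) (_∘ Equivalence.from (ones-IsOnes r p))))

  scheduleConstructible⇔orderConstructible : {r : Vector ℕ N} → ScheduleConstructible r ⇔ OrderConstructible r
  scheduleConstructible⇔orderConstructible = mk⇔
    (λ (U , 0∈U , last∈U , π , schedule , r≗run) → case schedule⇒order schedule of λ where
      (θ , rUθ≡run) → U , 0∈U , last∈U , θ , λ v → trans (r≗run v) (cong (λ f → f v) (sym rUθ≡run)))
    (λ (U , 0∈U , last∈U , θ , r≗rUθ) → U , 0∈U , last∈U , scheduleOf θ , order-schedule θ ,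
      λ v → trans (r≗rUθ v) (cong (λ f → f v) (rUθ≡run θ)))

corollary6p3 : (k : ℕ) → (r : Vector ℕ (suc (suc k))) →
    (Σ (Vector ℕ (suc (suc k))) (λ d → IsArithStruct (suc (suc k)) d r))
    ⇔ (Σ (Subset (suc (suc k))) (λ U →
         (zero ∈ U) × (fromℕ (suc k) ∈ U) ×
         Σ (Order U) (λ θ → (v : Fin (suc (suc k))) → r v ≡ rUθ U θ v)))
corollary6p3 k r = ⇔-trans
  (mk⇔ arithStructure⇒scheduleConstructible scheduleConstructible⇒arithStructure)
  scheduleConstructible⇔orderConstructible
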